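{- Let $p>3$ be a prime, $q=p^h$, and $a,b\in\mathbb{F}_{q^2}^*$. If $\gcd(a^qX^3+X^2+b^q,\ bX^3+X+a)$ has degree $1$, then $f_{a,b}(X)=X(1+aX^{q(q-1)}+bX^{2(q-1)})$ is not a permutation polynomial of $\mathbb{F}_{q^2}$.
   Context: A polynomial is a permutation polynomial of $\mathbb{F}_{q^2}$ if it induces a bijection of $\mathbb{F}_{q^2}$. The gcd is taken in $\mathbb{F}_{q^2}[X]$. -}

module Defs where

open import Level using (Level; _⊔_) renaming (suc to lsuc)
open import Algebra.Bundles using (CommutativeRing)
open import Data.Nat as ℕ using (ℕ; zero; suc)
open import Data.Fin using (Fin)
open import Data.List using (List; []; _∷_; map)
open import Data.List.Relation.Unary.All using (All)
open import Data.Product using (Σ; ∃; _×_; _,_)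
open import Data.Unit.Polymorphic using (⊤)
open import Relation.Nullary using (¬_)
open import Relation.Binary.PropositionalEquality using (_≡_)

record Field (c ℓ : Level) : Set (lsuc (c ⊔ ℓ)) where
  field
    commutativeRing : CommutativeRing c ℓ
  open CommutativeRing commutativeRing public
  field
    1≉0 : ¬ (1# ≈ 0#)
    inverse : ∀ x → ¬ (x ≈ 0#) → ∃ λ y → (x * y) ≈ 1#

module FieldOps {c ℓ : Level} (F : Field c ℓ) where
  open Field F

  HasCardinality : ℕ → Set (c ⊔ ℓ)
  HasCardinality n =
    Σ (Fin n → Carrier) λ e →
      (∀ i j → e i ≈ e j → i ≡ j) × (∀ x → ∃ λ i → e i ≈ x)

  infixr 8 _^F_
  _^F_ : Carrier → ℕ → Carrier
  x ^F zero = 1#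
  x ^F suc n = x * (x ^F n)

  IsBijection : (Carrier → Carrier) → Set (c ⊔ ℓ)
  IsBijection φ =
    (∀ x y → φ x ≈ φ y → x ≈ y) × (∀ y → ∃ λ x → φ x ≈ y)

  -- Polynomials in F[X] as coefficient lists, lowest degree first.
  Poly : Set c
  Poly = List Carrier

  IsZeroPoly : Poly → Set (c ⊔ ℓ)
  IsZeroPoly = All (_≈ 0#)

  infix 4 _≈P_
  _≈P_ : Poly → Poly → Set (c ⊔ ℓ)
  [] ≈P g = IsZeroPoly g
  (a ∷ f) ≈P [] = IsZeroPoly (a ∷ f)
  (a ∷ f) ≈P (b ∷ g) = (a ≈ b) × (f ≈P g)

  infixl 6 _+P_
  _+P_ : Poly → Poly → Poly
  [] +P g = g
  (a ∷ f) +P [] = a ∷ f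
  (a ∷ f) +P (b ∷ g) = (a + b) ∷ (f +P g)

  infixl 7 _*P_
  _*P_ : Poly → Poly → Poly
  [] *P g = []
  (a ∷ f) *P g = map (a *_) g +P (0# ∷ (f *P g))

  infix 4 _∣P_
  _∣P_ : Poly → Poly → Set (c ⊔ ℓ)
  d ∣P f = ∃ λ e → (d *P e) ≈P f

  HasDegreeOne : Poly → Set (c ⊔ ℓ)
  HasDegreeOne d = ∃ λ c0 → ∃ λ c1 → ¬ (c1 ≈ 0#) × (d ≈P (c0 ∷ c1 ∷ []))

  HasDegree≤1 : Poly → Set (c ⊔ ℓ)
  HasDegree≤1 d = ∃ λ c0 → ∃ λ c1 → d ≈P (c0 ∷ c1 ∷ [])

  -- gcd(f , g) has degree 1: there is a common divisor of degree 1, and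
  -- every common divisor has degree ≤ 1 (the gcd is a common divisor of
  -- maximal degree, unique up to a unit).
  GcdHasDegreeOne : Poly → Poly → Set (c ⊔ ℓ)
  GcdHasDegreeOne f g =
    (∃ λ d → HasDegreeOne d × (d ∣P f) × (d ∣P g)) ×
    (∀ d → d ∣P f → d ∣P g → HasDegree≤1 d)

-- A common root ρ of G = a^q X³ + X² + b^q and H = b X³ + X + a is nonzero (as b ≠ 0),
-- and ρ ↦ ρ^(-q) exchanges the roots of G and H, since the reversal of each is the
-- q-Frobenius conjugate of the other. If ρ^(-q) ≠ ρ, then (X - ρ)(X - ρ^(-q)) divides both
-- and the gcd has degree 2; hence ρ^(q+1) = 1. By Hilbert 90, ρ = x^(q-1) for some x ≠ 0
-- (x = z + ρ^q z^q for a suitable z), and then f(x) = x (1 + a ρ^q + b ρ²) = x ρ⁻¹ H(ρ) = 0 = f(0).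
-- The finite-field facts behind this are x^(q²) = x (a product over F), characteristic p
-- (a sum over F) and that X^q - X has at most q roots.
module Submission where

open import Defs
open import Level using (Level; _⊔_)
open import Data.Nat as ℕ using (ℕ; zero; suc; _<_; _≤_; _∸_; _!; z≤n; s≤s; NonZero)
  renaming (_^_ to _^ℕ_; _*_ to _*ℕ_)
import Data.Nat.Properties as ℕ
open import Data.Nat.Divisibility using (_∣_; divides; ∣⇒≤; ∣1⇒≡1; m∣m*n)
open import Data.Nat.Combinatorics using (_C_; nCn≡1; nCk≡n!/k![n-k]!; k![n∸k]!∣n!)
open import Data.Nat.DivMod using (m/n*n≡m)
open import Data.Nat.Primality using (Prime; ¬prime[0]; euclidsLemma; prime⇒nonTrivial)
open import Data.Fin as Fin using (Fin; zero; suc; fromℕ; inject₁; punchIn)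
import Data.Fin.Properties as Fin
open import Data.List using (List; []; _∷_; length; map)
open import Data.List.Relation.Unary.All using ([]; _∷_)
open import Data.Maybe using (nothing)
open import Data.Product using (∃; _,_; proj₁; proj₂)
open import Data.Sum using (inj₁; inj₂)
open import Data.Vec.Functional using (Vector; removeAt)
open import Relation.Nullary using (¬_; contradiction)
open import Relation.Binary.PropositionalEquality as ≡ using (_≡_; _≢_)

prime∤* : ∀ {p m n} → Prime p → ¬ p ∣ m → ¬ p ∣ n → ¬ p ∣ m *ℕ n
prime∤* {m = m} {n} p-prime p∤m p∤n p∣m*n with euclidsLemma m n p-prime p∣m*n
... | inj₁ p∣m = p∤m p∣m
... | inj₂ p∣n = p∤n p∣n

prime∤! : ∀ {p} m → Prime p → m < p → ¬ p ∣ m !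
prime∤! zero p-prime _ p∣1 = ℕ.nonTrivial⇒≢1 {{prime⇒nonTrivial p-prime}} (∣1⇒≡1 p∣1)
prime∤! (suc m) p-prime m<p = prime∤* p-prime (λ p∣1+m → ℕ.<⇒≱ m<p (∣⇒≤ p∣1+m))
  (prime∤! m p-prime (ℕ.<-trans (ℕ.n<1+n m) m<p))

n∣n! : ∀ n → .{{NonZero n}} → n ∣ n !
n∣n! (suc n) = m∣m*n (n !)

prime∣pCk : ∀ {p k} → Prime p → 0 < k → k < p → p ∣ p C k
prime∣pCk {p} {k} p-prime 0<k k<p with euclidsLemma (p C k) (k ! *ℕ (p ∸ k) !) p-prime p∣p!
  where
  instance
    _ = ℕ._!*_!≢0 k (p ∸ k)
    _ = ℕ.nonTrivial⇒nonZero p {{prime⇒nonTrivial p-prime}}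
  p∣p! : p ∣ (p C k) *ℕ (k ! *ℕ (p ∸ k) !)
  p∣p! = ≡.subst (p ∣_)
    (≡.sym (≡.trans (≡.cong (_*ℕ (k ! *ℕ (p ∸ k) !)) (nCk≡n!/k![n-k]! (ℕ.<⇒≤ k<p)))
                    (m/n*n≡m (k![n∸k]!∣n! (ℕ.<⇒≤ k<p)))))
    (n∣n! p)
... | inj₁ p∣pCk = p∣pCk
... | inj₂ p∣k![p-k]! = contradiction p∣k![p-k]!
  (prime∤* p-prime (prime∤! k p-prime k<p) (prime∤! (p ∸ k) p-prime (ℕ.∸-monoʳ-< 0<k (ℕ.<⇒≤ k<p))))

module FieldProperties {c ℓ : Level} (F : Field c ℓ) where
  open import Data.Product using (_×_)
  open Field F hiding (zero)
  open FieldOps F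
  open import Relation.Binary.Reasoning.Setoid setoid
  open import Algebra.Properties.Ring ring using ([y-z]x≈yx-zx; -1*x≈-x; -‿distribˡ-*; x+x≈x⇒x≈0)
  open import Algebra.Properties.Group +-group using (x∙y⁻¹≈ε⇒x≈y)
  open import Algebra.Properties.CommutativeMonoid.Sum *-commutativeMonoid as Product using ()
    renaming (sum to product)
  open import Algebra.Properties.Semiring.Exp semiring as Exp using (_^_)
  open import Algebra.Properties.CommutativeSemiring.Exp commutativeSemiring using (^-distrib-*)
  open import Algebra.Solver.Ring.NaturalCoefficients commutativeSemiring (λ _ _ → nothing)
    using (solve; _:=_; _:+_; _:*_; con)

  inv : (x : Carrier) → ¬ x ≈ 0# → Carrier
  inv x x≉0 = proj₁ (inverse x x≉0)

  *-inverseʳ : ∀ x (x≉0 : ¬ x ≈ 0#) → x * inv x x≉0 ≈ 1#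
  *-inverseʳ x x≉0 = proj₂ (inverse x x≉0)

  *-cancelˡ : ∀ {x y z} → ¬ x ≈ 0# → x * y ≈ x * z → y ≈ z
  *-cancelˡ {x} {y} {z} x≉0 xy≈xz = begin
    y             ≈⟨ *-identityˡ y ⟨
    1# * y        ≈⟨ *-congʳ x⁻¹x≈1 ⟨
    x⁻¹ * x * y   ≈⟨ *-assoc x⁻¹ x y ⟩
    x⁻¹ * (x * y) ≈⟨ *-congˡ xy≈xz ⟩
    x⁻¹ * (x * z) ≈⟨ *-assoc x⁻¹ x z ⟨
    x⁻¹ * x * z   ≈⟨ *-congʳ x⁻¹x≈1 ⟩
    1# * z        ≈⟨ *-identityˡ z ⟩
    z             ∎
    where
    x⁻¹ = inv x x≉0
    x⁻¹x≈1 = trans (*-comm x⁻¹ x) (*-inverseʳ x x≉0)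

  x*y≈0⇒y≈0 : ∀ {x y} → ¬ x ≈ 0# → x * y ≈ 0# → y ≈ 0#
  x*y≈0⇒y≈0 {x} x≉0 xy≈0 = *-cancelˡ x≉0 (trans xy≈0 (sym (zeroʳ x)))

  *-cancelʳ : ∀ {x y z} → ¬ z ≈ 0# → x * z ≈ y * z → x ≈ y
  *-cancelʳ {x} {y} {z} z≉0 xz≈yz = *-cancelˡ z≉0 (trans (*-comm z x) (trans xz≈yz (*-comm y z)))

  x*y≉0 : ∀ {x y} → ¬ x ≈ 0# → ¬ y ≈ 0# → ¬ x * y ≈ 0#
  x*y≉0 x≉0 y≉0 xy≈0 = y≉0 (x*y≈0⇒y≈0 x≉0 xy≈0)

  x*z≈y*z⇒z≈0 : ∀ {x y z} → ¬ x ≈ y → x * z ≈ y * z → z ≈ 0#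
  x*z≈y*z⇒z≈0 {x} {y} {z} x≉y xz≈yz = x*y≈0⇒y≈0 (λ x-y≈0 → x≉y (x∙y⁻¹≈ε⇒x≈y x y x-y≈0)) (begin
    (x - y) * z   ≈⟨ [y-z]x≈yx-zx z x y ⟩
    x * z - y * z ≈⟨ +-congʳ xz≈yz ⟩
    y * z - y * z ≈⟨ -‿inverseʳ (y * z) ⟩
    0#            ∎)

  x≈y+z⇒x-z≈y : ∀ {x y z} → x ≈ y + z → x - z ≈ y
  x≈y+z⇒x-z≈y {x} {y} {z} x≈y+z = begin
    x - z       ≈⟨ +-congʳ x≈y+z ⟩
    y + z - z   ≈⟨ +-assoc y z (- z) ⟩
    y + (z - z) ≈⟨ +-congˡ (-‿inverseʳ z) ⟩
    y + 0#      ≈⟨ +-identityʳ y ⟩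
    y           ∎

  ^F≈^ : ∀ x n → x ^F n ≈ x ^ n
  ^F≈^ x zero = refl
  ^F≈^ x (suc n) = *-congˡ (^F≈^ x n)

  ^F-congˡ : ∀ n {x y} → x ≈ y → x ^F n ≈ y ^F n
  ^F-congˡ zero x≈y = refl
  ^F-congˡ (suc n) x≈y = *-cong x≈y (^F-congˡ n x≈y)

  ^F-assocʳ : ∀ x m n → (x ^F m) ^F n ≈ x ^F (m *ℕ n)
  ^F-assocʳ x m n = begin
    (x ^F m) ^F n ≈⟨ ^F≈^ (x ^F m) n ⟩
    (x ^F m) ^ n  ≈⟨ Exp.^-congˡ n (^F≈^ x m) ⟩
    (x ^ m) ^ n   ≈⟨ Exp.^-assocʳ x m n ⟩
    x ^ (m *ℕ n)  ≈⟨ ^F≈^ x (m *ℕ n) ⟨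
    x ^F (m *ℕ n) ∎

  ^F-distrib-* : ∀ x y n → (x * y) ^F n ≈ x ^F n * y ^F n
  ^F-distrib-* x y n = begin
    (x * y) ^F n    ≈⟨ ^F≈^ (x * y) n ⟩
    (x * y) ^ n     ≈⟨ ^-distrib-* x y n ⟩
    x ^ n * y ^ n   ≈⟨ *-cong (^F≈^ x n) (^F≈^ y n) ⟨
    x ^F n * y ^F n ∎

  1^F≈1 : ∀ n → 1# ^F n ≈ 1#
  1^F≈1 zero = refl
  1^F≈1 (suc n) = trans (*-identityˡ _) (1^F≈1 n)

  0^F≈0 : ∀ n → .{{NonZero n}} → 0# ^F n ≈ 0#
  0^F≈0 (suc n) = zeroˡ (0# ^F n)

  ^F-nonZero : ∀ {x} n → ¬ x ≈ 0# → ¬ x ^F n ≈ 0#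
  ^F-nonZero zero x≉0 = 1≉0
  ^F-nonZero (suc n) x≉0 = x*y≉0 x≉0 (^F-nonZero n x≉0)

  -- horner a cs y evaluates at y the polynomial with leading coefficient a
  -- followed by the coefficients cs, highest degree first.
  horner : Carrier → List Carrier → Carrier → Carrier
  horner a [] y = a
  horner a (c ∷ cs) y = horner (a * y + c) cs y

  synthDiv : Carrier → Carrier → List Carrier → List Carrier
  synthDiv z b [] = []
  synthDiv z b (c ∷ cs) = b ∷ synthDiv z (b * z + c) cs

  length-synthDiv : ∀ z b cs → length (synthDiv z b cs) ≡ length cs
  length-synthDiv z b [] = ≡.refl
  length-synthDiv z b (c ∷ cs) = ≡.cong suc (length-synthDiv z (b * z + c) cs)

  -- Division by X - z, with the subtraction moved across so that every
  -- step is a semiring identity.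
  horner-synthDiv : ∀ {a u b} z y cs → a + z * u ≈ y * u + b →
    horner a cs y + z * horner u (synthDiv z b cs) y ≈ y * horner u (synthDiv z b cs) y + horner b cs z
  horner-synthDiv z y [] a+zu≈yu+b = a+zu≈yu+b
  horner-synthDiv {a} {u} {b} z y (c ∷ cs) a+zu≈yu+b = horner-synthDiv z y cs (begin
    (a * y + c) + z * (u * y + b) ≈⟨ solve 6 (λ a y c z u b →
                                      (a :* y :+ c) :+ z :* (u :* y :+ b) := (a :+ z :* u) :* y :+ (c :+ z :* b))
                                      refl a y c z u b ⟩
    (a + z * u) * y + (c + z * b) ≈⟨ +-congʳ (*-congʳ a+zu≈yu+b) ⟩
    (y * u + b) * y + (c + z * b) ≈⟨ solve 5 (λ y u b c z →
                                      (y :* u :+ b) :* y :+ (c :+ z :* b) := y :* (u :* y :+ b) :+ (b :* z :+ c))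
                                      refl y u b c z ⟩
    y * (u * y + b) + (b * z + c) ∎)

  root-bound : ∀ {a m} cs → ¬ a ≈ 0# → (g : Fin m → Carrier) → (∀ i j → g i ≈ g j → i ≡ j) →
               (∀ i → horner a cs (g i) ≈ 0#) → m ≤ length cs
  root-bound {m = zero} cs _ _ _ _ = z≤n
  root-bound {m = suc m} [] a≉0 g _ roots = contradiction (roots zero) a≉0
  root-bound {a} {suc m} (c ∷ cs) a≉0 g g-injective roots =
    s≤s (≡.subst (m ≤_) (length-synthDiv z (a * z + c) cs)
      (root-bound (synthDiv z (a * z + c) cs) a≉0 (λ i → g (suc i))
        (λ i j gi≈gj → Fin.suc-injective (g-injective (suc i) (suc j) gi≈gj)) quotient-roots))
    where
    z = g zero
    quotient-roots : ∀ i → horner a (synthDiv z (a * z + c) cs) (g (suc i)) ≈ 0#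
    quotient-roots i = x*z≈y*z⇒z≈0 z≉y (begin
      z * Q                                  ≈⟨ +-identityˡ (z * Q) ⟨
      0# + z * Q                             ≈⟨ +-congʳ (roots (suc i)) ⟨
      horner a (c ∷ cs) y + z * Q            ≈⟨ horner-synthDiv z y cs (solve 4 (λ a y c z →
                                                  (a :* y :+ c) :+ z :* a := y :* a :+ (a :* z :+ c)) refl a y c z) ⟩
      y * Q + horner a (c ∷ cs) z            ≈⟨ +-congˡ (roots zero) ⟩
      y * Q + 0#                             ≈⟨ +-identityʳ (y * Q) ⟩
      y * Q                                  ∎)
      where
      y = g (suc i)
      Q = horner a (synthDiv z (a * z + c) cs) y
      z≉y : ¬ z ≈ y
      z≉y z≈y = Fin.0≢1+n (g-injective zero (suc i) z≈y)

  X^[2+k]-X : ℕ → List Carrier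
  X^[2+k]-X zero = - 1# ∷ 0# ∷ []
  X^[2+k]-X (suc k) = 0# ∷ X^[2+k]-X k

  length-X^[2+k]-X : ∀ k → length (X^[2+k]-X k) ≡ 2 ℕ.+ k
  length-X^[2+k]-X zero = ≡.refl
  length-X^[2+k]-X (suc k) = ≡.cong suc (length-X^[2+k]-X k)

  horner-X^[2+k]-X : ∀ a k y → horner a (X^[2+k]-X k) y ≈ a * y ^F (2 ℕ.+ k) - y
  horner-X^[2+k]-X a zero y = begin
    (a * y + - 1#) * y + 0# ≈⟨ +-identityʳ _ ⟩
    (a * y + - 1#) * y      ≈⟨ distribʳ y (a * y) (- 1#) ⟩
    a * y * y + - 1# * y    ≈⟨ +-cong (solve 2 (λ a y → a :* y :* y := a :* (y :* (y :* con 1))) refl a y) (-1*x≈-x y) ⟩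
    a * y ^F 2 - y          ∎
  horner-X^[2+k]-X a (suc k) y = trans (horner-X^[2+k]-X (a * y + 0#) k y)
    (+-congʳ (trans (*-congʳ (+-identityʳ (a * y))) (*-assoc a y (y ^F (2 ℕ.+ k)))))

  eval : Poly → Carrier → Carrier
  eval [] y = 0#
  eval (a ∷ f) y = a + y * eval f y

  eval-zero : ∀ f y → IsZeroPoly f → eval f y ≈ 0#
  eval-zero [] y [] = refl
  eval-zero (a ∷ f) y (a≈0 ∷ f≈0) = begin
    a + y * eval f y ≈⟨ +-cong a≈0 (*-congˡ (eval-zero f y f≈0)) ⟩
    0# + y * 0#      ≈⟨ +-identityˡ (y * 0#) ⟩
    y * 0#           ≈⟨ zeroʳ y ⟩
    0#               ∎

  eval-at-0 : ∀ a f {y} → y ≈ 0# → eval (a ∷ f) y ≈ a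
  eval-at-0 a f {y} y≈0 = trans (+-congˡ (trans (*-congʳ y≈0) (zeroˡ (eval f y)))) (+-identityʳ a)

  eval-cong : ∀ f g y → f ≈P g → eval f y ≈ eval g y
  eval-cong [] g y []≈g = sym (eval-zero g y []≈g)
  eval-cong (a ∷ f) [] y f≈[] = eval-zero (a ∷ f) y f≈[]
  eval-cong (a ∷ f) (b ∷ g) y (a≈b , f≈g) = +-cong a≈b (*-congˡ (eval-cong f g y f≈g))

  eval-+P : ∀ f g y → eval (f +P g) y ≈ eval f y + eval g y
  eval-+P [] g y = sym (+-identityˡ _)
  eval-+P (a ∷ f) [] y = sym (+-identityʳ _)
  eval-+P (a ∷ f) (b ∷ g) y = trans (+-congˡ (*-congˡ (eval-+P f g y)))
    (solve 5 (λ a b y F G → (a :+ b) :+ y :* (F :+ G) := (a :+ y :* F) :+ (b :+ y :* G)) refl a b y (eval f y) (eval g y))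

  eval-scale : ∀ a g y → eval (map (a *_) g) y ≈ a * eval g y
  eval-scale a [] y = sym (zeroʳ a)
  eval-scale a (b ∷ g) y = trans (+-congˡ (*-congˡ (eval-scale a g y)))
    (solve 4 (λ a b y G → a :* b :+ y :* (a :* G) := a :* (b :+ y :* G)) refl a b y (eval g y))

  eval-*P : ∀ f g y → eval (f *P g) y ≈ eval f y * eval g y
  eval-*P [] g y = sym (zeroˡ _)
  eval-*P (a ∷ f) g y = begin
    eval (map (a *_) g +P (0# ∷ f *P g)) y      ≈⟨ eval-+P (map (a *_) g) (0# ∷ f *P g) y ⟩
    eval (map (a *_) g) y + (0# + y * eval (f *P g) y)
                                                ≈⟨ +-cong (eval-scale a g y) (trans (+-identityˡ _) (*-congˡ (eval-*P f g y))) ⟩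
    a * eval g y + y * (eval f y * eval g y)    ≈⟨ solve 4 (λ a G y F → a :* G :+ y :* (F :* G) := (a :+ y :* F) :* G)
                                                     refl a (eval g y) y (eval f y) ⟩
    (a + y * eval f y) * eval g y               ∎

  root-of-divisor : ∀ d {f} y → d ∣P f → eval d y ≈ 0# → eval f y ≈ 0#
  root-of-divisor d {f} y (e , d*e≈f) dy≈0 = begin
    eval f y            ≈⟨ eval-cong (d *P e) f y d*e≈f ⟨
    eval (d *P e) y     ≈⟨ eval-*P d e y ⟩
    eval d y * eval e y ≈⟨ *-congʳ dy≈0 ⟩
    0# * eval e y       ≈⟨ zeroˡ _ ⟩
    0#                  ∎

  degreeOne-root : ∀ {d} → HasDegreeOne d → ∃ λ r → eval d r ≈ 0#
  degreeOne-root {d} (c₀ , c₁ , c₁≉0 , d≈c₀+c₁X) = r , (begin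
    eval d r                   ≈⟨ eval-cong d (c₀ ∷ c₁ ∷ []) r d≈c₀+c₁X ⟩
    c₀ + r * (c₁ + r * 0#)     ≈⟨ +-congˡ (*-congˡ (trans (+-congˡ (zeroʳ r)) (+-identityʳ c₁))) ⟩
    c₀ + r * c₁                ≈⟨ +-congˡ (-‿distribˡ-* (c₀ * c₁⁻¹) c₁) ⟨
    c₀ - c₀ * c₁⁻¹ * c₁        ≈⟨ +-congˡ (-‿cong c₀c₁⁻¹c₁≈c₀) ⟩
    c₀ - c₀                    ≈⟨ -‿inverseʳ c₀ ⟩
    0#                         ∎)
    where
    c₁⁻¹ = inv c₁ c₁≉0
    r = - (c₀ * c₁⁻¹)
    c₀c₁⁻¹c₁≈c₀ : c₀ * c₁⁻¹ * c₁ ≈ c₀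
    c₀c₁⁻¹c₁≈c₀ = trans (*-assoc c₀ c₁⁻¹ c₁)
                    (trans (*-congˡ (trans (*-comm c₁⁻¹ c₁) (*-inverseʳ c₁ c₁≉0))) (*-identityʳ c₀))

  AdditivePower : ℕ → Set (c ⊔ ℓ)
  AdditivePower q = ∀ x y → (x + y) ^F q ≈ x ^F q + y ^F q

  additive⇒0^F≈0 : ∀ q → AdditivePower q → 0# ^F q ≈ 0#
  additive⇒0^F≈0 q additive = x+x≈x⇒x≈0 (0# ^F q)
    (sym (trans (^F-congˡ q (sym (+-identityʳ 0#))) (additive 0# 0#)))

  eval-^F : ∀ q → AdditivePower q → ∀ f y → eval f y ^F q ≈ eval (map (_^F q) f) (y ^F q)
  eval-^F q additive [] y = additive⇒0^F≈0 q additive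
  eval-^F q additive (a ∷ f) y = begin
    (a + y * eval f y) ^F q                     ≈⟨ additive a (y * eval f y) ⟩
    a ^F q + (y * eval f y) ^F q                ≈⟨ +-congˡ (^F-distrib-* y (eval f y) q) ⟩
    a ^F q + y ^F q * eval f y ^F q             ≈⟨ +-congˡ (*-congˡ (eval-^F q additive f y)) ⟩
    a ^F q + y ^F q * eval (map (_^F q) f) (y ^F q) ∎

  eval-cubic : ∀ c₀ c₁ c₂ c₃ y → eval (c₀ ∷ c₁ ∷ c₂ ∷ c₃ ∷ []) y ≈ c₀ + y * (c₁ + y * (c₂ + y * c₃))
  eval-cubic c₀ c₁ c₂ c₃ y =
    +-congˡ (*-congˡ (+-congˡ (*-congˡ (+-congˡ (*-congˡ (trans (+-congˡ (zeroʳ y)) (+-identityʳ c₃)))))))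

  eval-reverse-cubic : ∀ c₀ c₁ c₂ c₃ {y t} → t * y ≈ 1# →
    t * (t * t) * eval (c₀ ∷ c₁ ∷ c₂ ∷ c₃ ∷ []) y ≈ eval (c₃ ∷ c₂ ∷ c₁ ∷ c₀ ∷ []) t
  eval-reverse-cubic c₀ c₁ c₂ c₃ {y} {t} ty≈1 = begin
    t * (t * t) * eval (c₀ ∷ c₁ ∷ c₂ ∷ c₃ ∷ []) y
      ≈⟨ *-congˡ (eval-cubic c₀ c₁ c₂ c₃ y) ⟩
    t * (t * t) * (c₀ + y * (c₁ + y * (c₂ + y * c₃)))
      ≈⟨ solve 6 (λ c₀ c₁ c₂ c₃ y t →
           t :* (t :* t) :* (c₀ :+ y :* (c₁ :+ y :* (c₂ :+ y :* c₃)))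
           := c₃ :* ((t :* y) :* ((t :* y) :* (t :* y)))
              :+ t :* (c₂ :* ((t :* y) :* (t :* y)) :+ t :* (c₁ :* (t :* y) :+ t :* c₀)))
           refl c₀ c₁ c₂ c₃ y t ⟩
    c₃ * (u * (u * u)) + t * (c₂ * (u * u) + t * (c₁ * u + t * c₀))
      ≈⟨ +-cong (scale u³≈1) (*-congˡ (+-cong (scale u²≈1) (*-congˡ (+-congʳ (scale ty≈1))))) ⟩
    c₃ + t * (c₂ + t * (c₁ + t * c₀))
      ≈⟨ eval-cubic c₃ c₂ c₁ c₀ t ⟨
    eval (c₃ ∷ c₂ ∷ c₁ ∷ c₀ ∷ []) t ∎
    where
    u = t * y
    u²≈1 = trans (*-cong ty≈1 ty≈1) (*-identityˡ 1#)
    u³≈1 = trans (*-cong ty≈1 u²≈1) (*-identityˡ 1#)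
    scale : ∀ {x v} → v ≈ 1# → x * v ≈ x
    scale {x} v≈1 = trans (*-congˡ v≈1) (*-identityʳ x)

  quadraticWithRoots : Carrier → Carrier → Poly
  quadraticWithRoots r s = r * s ∷ - (r + s) ∷ 1# ∷ []

  ¬degree≤1-quadraticWithRoots : ∀ r s → ¬ HasDegree≤1 (quadraticWithRoots r s)
  ¬degree≤1-quadraticWithRoots r s (_ , _ , _ , _ , 1≈0 ∷ _) = 1≉0 1≈0

  quadraticWithRoots∣cubic : ∀ c₀ c₁ c₂ c₃ {r s} → ¬ r ≈ s →
    eval (c₀ ∷ c₁ ∷ c₂ ∷ c₃ ∷ []) r ≈ 0# → eval (c₀ ∷ c₁ ∷ c₂ ∷ c₃ ∷ []) s ≈ 0# →
    quadraticWithRoots r s ∣P (c₀ ∷ c₁ ∷ c₂ ∷ c₃ ∷ [])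
  quadraticWithRoots∣cubic c₀ c₁ c₂ c₃ {r} {s} r≉s fr≈0 fs≈0 =
    (e₀ ∷ c₃ ∷ []) , (coeff₀ , coeff₁ , coeff₂ , *-identityˡ c₃ , [])
    where
    σ = r + s
    e₀ = c₂ + σ * c₃
    -- the divided difference (f r - f s) / (r - s)
    K = c₁ + σ * c₂ + (r * r + r * s + s * s) * c₃
    cubic : Carrier → Carrier
    cubic y = c₀ + y * (c₁ + y * (c₂ + y * c₃))
    cubic-r≈0 = trans (sym (eval-cubic c₀ c₁ c₂ c₃ r)) fr≈0
    cubic-s≈0 = trans (sym (eval-cubic c₀ c₁ c₂ c₃ s)) fs≈0
    K≈0 : K ≈ 0#
    K≈0 = x*z≈y*z⇒z≈0 (λ s≈r → r≉s (sym s≈r)) (begin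
      s * K           ≈⟨ +-identityˡ (s * K) ⟨
      0# + s * K      ≈⟨ +-congʳ cubic-r≈0 ⟨
      cubic r + s * K ≈⟨ solve 6 (λ c₀ c₁ c₂ c₃ r s →
                           (c₀ :+ r :* (c₁ :+ r :* (c₂ :+ r :* c₃)))
                             :+ s :* (c₁ :+ (r :+ s) :* c₂ :+ (r :* r :+ r :* s :+ s :* s) :* c₃)
                           := (c₀ :+ s :* (c₁ :+ s :* (c₂ :+ s :* c₃)))
                             :+ r :* (c₁ :+ (r :+ s) :* c₂ :+ (r :* r :+ r :* s :+ s :* s) :* c₃))
                           refl c₀ c₁ c₂ c₃ r s ⟩
      cubic s + r * K ≈⟨ +-congʳ cubic-s≈0 ⟩
      0# + r * K      ≈⟨ +-identityˡ (r * K) ⟩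
      r * K           ∎)
    coeff₀ : r * s * e₀ + 0# ≈ c₀
    coeff₀ = begin
      r * s * e₀ + 0#       ≈⟨ +-congˡ cubic-r≈0 ⟨
      r * s * e₀ + cubic r  ≈⟨ solve 6 (λ c₀ c₁ c₂ c₃ r s →
                                 r :* s :* (c₂ :+ (r :+ s) :* c₃) :+ (c₀ :+ r :* (c₁ :+ r :* (c₂ :+ r :* c₃)))
                                 := c₀ :+ r :* (c₁ :+ (r :+ s) :* c₂ :+ (r :* r :+ r :* s :+ s :* s) :* c₃))
                                 refl c₀ c₁ c₂ c₃ r s ⟩
      c₀ + r * K            ≈⟨ +-congˡ (trans (*-congˡ K≈0) (zeroʳ r)) ⟩
      c₀ + 0#               ≈⟨ +-identityʳ c₀ ⟩
      c₀                    ∎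
    coeff₁ : r * s * c₃ + (- σ * e₀ + 0#) ≈ c₁
    coeff₁ = begin
      r * s * c₃ + (- σ * e₀ + 0#) ≈⟨ +-congˡ (trans (+-identityʳ _) (sym (-‿distribˡ-* σ e₀))) ⟩
      r * s * c₃ - σ * e₀          ≈⟨ x≈y+z⇒x-z≈y (begin
        r * s * c₃                     ≈⟨ +-identityˡ _ ⟨
        0# + r * s * c₃                ≈⟨ +-congʳ K≈0 ⟨
        K + r * s * c₃                 ≈⟨ solve 5 (λ c₁ c₂ c₃ r s →
                                            c₁ :+ (r :+ s) :* c₂ :+ (r :* r :+ r :* s :+ s :* s) :* c₃ :+ r :* s :* c₃
                                            := c₁ :+ (r :+ s) :* (c₂ :+ (r :+ s) :* c₃))
                                            refl c₁ c₂ c₃ r s ⟩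
        c₁ + σ * e₀                    ∎) ⟩
      c₁                           ∎
    coeff₂ : - σ * c₃ + (1# * e₀ + 0#) ≈ c₂
    coeff₂ = begin
      - σ * c₃ + (1# * e₀ + 0#) ≈⟨ +-comm _ _ ⟩
      1# * e₀ + 0# + - σ * c₃   ≈⟨ +-cong (trans (+-identityʳ _) (*-identityˡ e₀)) (sym (-‿distribˡ-* σ c₃)) ⟩
      e₀ - σ * c₃               ≈⟨ x≈y+z⇒x-z≈y refl ⟩
      c₂                        ∎

  common-root : ∀ {f g} → GcdHasDegreeOne f g → ∃ λ r → eval f r ≈ 0# × eval g r ≈ 0#
  common-root ((d , d-degree , d∣f , d∣g) , _) with degreeOne-root d-degree
  ... | r , dr≈0 = r , root-of-divisor d r d∣f dr≈0 , root-of-divisor d r d∣g dr≈0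

  product-nonZero : ∀ {n} (f : Vector Carrier n) → (∀ i → ¬ f i ≈ 0#) → ¬ product f ≈ 0#
  product-nonZero {zero} f _ = 1≉0
  product-nonZero {suc n} f f≉0 = x*y≉0 (f≉0 zero) (product-nonZero (λ i → f (suc i)) (λ i → f≉0 (suc i)))

  product-except : ∀ {n} (f g : Vector Carrier n) i {x} → (∀ j → j ≢ i → f j ≈ g j) → f i ≈ x * g i →
                   product f ≈ x * product g
  product-except {suc n} f g i {x} f≈g fi≈x*gi = begin
    product f                            ≈⟨ Product.sum-remove {i = i} f ⟩
    f i * product (removeAt f i)         ≈⟨ *-cong fi≈x*gi (Product.sum-cong-≋ λ j →
                                              f≈g (punchIn i j) (Fin.punchInᵢ≢i i j)) ⟩
    x * g i * product (removeAt g i)     ≈⟨ *-assoc x (g i) _ ⟩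
    x * (g i * product (removeAt g i))   ≈⟨ *-congˡ (Product.sum-remove {i = i} g) ⟨
    x * product g                        ∎

module Frobenius {c ℓ : Level} (F : Field c ℓ) where
  open Field F hiding (zero)
  open FieldOps F
  open FieldProperties F
  open import Relation.Binary.Reasoning.Setoid setoid
  open import Algebra.Properties.Semiring.Exp semiring using (_^_)
  open import Algebra.Properties.Semiring.Mult semiring using (_×_; ×-congʳ; ×-assoc-*; ×1-homo-*)
  open import Algebra.Properties.Semiring.Sum semiring using (sum; sum-init-last; sum-cong-≋; sum-replicate-zero)
  open import Algebra.Properties.CommutativeSemiring.Binomial commutativeSemiring using (theorem; binomialTerm)
  open import Data.Vec.Functional using (tail; init; last)

  ×-vanish : ∀ {p n} → p × 1# ≈ 0# → p ∣ n → ∀ x → n × x ≈ 0#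
  ×-vanish {p} p×1≈0 (divides m ≡.refl) x = begin
    (m *ℕ p) × x              ≈⟨ ×-congʳ (m *ℕ p) (*-identityˡ x) ⟨
    (m *ℕ p) × (1# * x)       ≈⟨ ×-assoc-* (m *ℕ p) 1# x ⟨
    ((m *ℕ p) × 1#) * x       ≈⟨ *-congʳ (×1-homo-* m p) ⟩
    (m × 1#) * (p × 1#) * x   ≈⟨ *-congʳ (*-congˡ p×1≈0) ⟩
    (m × 1#) * 0# * x         ≈⟨ *-congʳ (zeroʳ (m × 1#)) ⟩
    0# * x                    ≈⟨ zeroˡ x ⟩
    0#                        ∎

  sum-ends : ∀ {n} (t : Vector Carrier (suc (suc n))) → (∀ i → t (suc (inject₁ i)) ≈ 0#) →
             sum t ≈ t zero + t (fromℕ (suc n))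
  sum-ends {n} t middle≈0 = +-congˡ (begin
    sum (tail t)                        ≈⟨ sum-init-last (tail t) ⟩
    sum (init (tail t)) + last (tail t) ≈⟨ +-congʳ (trans (sum-cong-≋ middle≈0) (sum-replicate-zero n)) ⟩
    0# + last (tail t)                  ≈⟨ +-identityˡ _ ⟩
    t (fromℕ (suc n))                   ∎)

  binomialTerm-last : ∀ x y n → binomialTerm x y n (fromℕ n) ≈ x ^F n
  binomialTerm-last x y n rewrite Fin.toℕ-fromℕ n | nCn≡1 n | ℕ.n∸n≡0 n = begin
    x ^ n * 1# + 0# ≈⟨ +-identityʳ _ ⟩
    x ^ n * 1#      ≈⟨ *-identityʳ _ ⟩
    x ^ n           ≈⟨ ^F≈^ x n ⟨
    x ^F n          ∎

  frobenius : ∀ {p} → Prime p → p × 1# ≈ 0# → ∀ x y → (x + y) ^F p ≈ x ^F p + y ^F p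
  frobenius {zero} p-prime = contradiction p-prime ¬prime[0]
  frobenius {suc n} p-prime p×1≈0 x y = begin
    (x + y) ^F suc n                        ≈⟨ ^F≈^ (x + y) (suc n) ⟩
    (x + y) ^ suc n                         ≈⟨ theorem (suc n) x y ⟩
    sum t                                   ≈⟨ sum-ends t middle≈0 ⟩
    t zero + t (fromℕ (suc n))              ≈⟨ +-comm _ _ ⟩
    t (fromℕ (suc n)) + (1# * y ^ suc n + 0#) ≈⟨ +-cong (binomialTerm-last x y (suc n)) y^p ⟩
    x ^F suc n + y ^F suc n                 ∎
    where
    t = binomialTerm x y (suc n)
    middle≈0 : ∀ i → t (suc (inject₁ i)) ≈ 0#
    middle≈0 i = ×-vanish p×1≈0 (prime∣pCk p-prime (s≤s z≤n) (s≤s (Fin.inject₁ℕ< i))) _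
    y^p : 1# * y ^ suc n + 0# ≈ y ^F suc n
    y^p = trans (+-identityʳ _) (trans (*-identityˡ _) (sym (^F≈^ y (suc n))))

  frobenius-^ : ∀ {p} → Prime p → p × 1# ≈ 0# → ∀ h → AdditivePower (p ^ℕ h)
  frobenius-^ p-prime p×1≈0 zero x y = trans (*-identityʳ _) (sym (+-cong (*-identityʳ x) (*-identityʳ y)))
  frobenius-^ {p} p-prime p×1≈0 (suc h) x y = begin
    (x + y) ^F (p *ℕ q)                ≈⟨ ^F-assocʳ (x + y) p q ⟨
    ((x + y) ^F p) ^F q                ≈⟨ ^F-congˡ q (frobenius p-prime p×1≈0 x y) ⟩
    (x ^F p + y ^F p) ^F q             ≈⟨ frobenius-^ p-prime p×1≈0 h (x ^F p) (y ^F p) ⟩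
    (x ^F p) ^F q + (y ^F p) ^F q      ≈⟨ +-cong (^F-assocʳ x p q) (^F-assocʳ y p q) ⟩
    x ^F (p *ℕ q) + y ^F (p *ℕ q)      ∎
    where q = p ^ℕ h

module FiniteFieldProperties {c ℓ : Level} (F : Field c ℓ) {N : ℕ} (card : FieldOps.HasCardinality F N) where
  open Field F hiding (zero)
  open FieldOps F
  open FieldProperties F
  open import Relation.Binary.Reasoning.Setoid setoid
  open import Relation.Binary.Definitions using (Decidable)
  open import Relation.Nullary using (yes; no)
  open import Algebra.Properties.Semiring.Exp semiring using (_^_)
  open import Data.Fin.Permutation using (Permutation; permutation; _⟨$⟩ʳ_)
  open import Algebra.Properties.Group +-group using (identityʳ-unique)
  open import Algebra.Properties.Semiring.Mult semiring using (_×_; ×1-homo-*)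
  open import Algebra.Properties.CommutativeMonoid.Sum +-commutativeMonoid
    using (sum; sum-cong-≋; ∑-permute; ∑-distrib-+; sum-replicate)
  open import Algebra.Properties.CommutativeMonoid.Sum *-commutativeMonoid as Product using ()
    renaming (sum to product)

  enum : Fin N → Carrier
  enum = proj₁ card

  enum-injective : ∀ i j → enum i ≈ enum j → i ≡ j
  enum-injective = proj₁ (proj₂ card)

  index : Carrier → Fin N
  index x = proj₁ (proj₂ (proj₂ card) x)

  enum-index : ∀ x → enum (index x) ≈ x
  enum-index x = proj₂ (proj₂ (proj₂ card) x)

  index-unique : ∀ {x i} → enum i ≈ x → index x ≡ i
  index-unique {x} {i} enum-i≈x = enum-injective _ _ (trans (enum-index x) (sym enum-i≈x))

  instance
    N-nonZero : NonZero N
    N-nonZero = Fin.nonZeroIndex (index 0#)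

  infix 4 _≟_
  _≟_ : Decidable _≈_
  x ≟ y with index x Fin.≟ index y
  ... | yes ix≡iy = yes (trans (sym (enum-index x)) (trans (reflexive (≡.cong enum ix≡iy)) (enum-index y)))
  ... | no ix≢iy = no (λ x≈y → ix≢iy (index-unique (trans (enum-index y) (sym x≈y))))

  reindexing : (φ ψ : Carrier → Carrier) →
               (∀ {x y} → x ≈ y → φ x ≈ φ y) → (∀ {x y} → x ≈ y → ψ x ≈ ψ y) →
               (∀ x → φ (ψ x) ≈ x) → (∀ x → ψ (φ x) ≈ x) → Permutation N N
  reindexing φ ψ φ-cong ψ-cong φψ≈id ψφ≈id = permutation (λ i → index (φ (enum i))) (λ i → index (ψ (enum i)))
    (λ i → index-unique (sym (trans (φ-cong (enum-index _)) (φψ≈id (enum i)))))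
    (λ i → index-unique (sym (trans (ψ-cong (enum-index _)) (ψφ≈id (enum i)))))

  characteristic∣N : N × 1# ≈ 0#
  characteristic∣N = identityʳ-unique (sum enum) (N × 1#) (sym (begin
    sum enum                                ≈⟨ ∑-permute enum π ⟩
    sum (λ i → enum (π ⟨$⟩ʳ i))             ≈⟨ sum-cong-≋ (λ i → enum-index (enum i + 1#)) ⟩
    sum (λ i → enum i + 1#)                 ≈⟨ ∑-distrib-+ enum (λ _ → 1#) ⟩
    sum enum + sum {N} (λ _ → 1#)           ≈⟨ +-congˡ (sum-replicate N) ⟩
    sum enum + N × 1#                       ∎))
    where
    π = reindexing (_+ 1#) (_- 1#) +-congʳ +-congʳ
      (λ x → trans (+-assoc x (- 1#) 1#) (trans (+-congˡ (-‿inverseˡ 1#)) (+-identityʳ x)))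
      (λ x → trans (+-assoc x 1# (- 1#)) (trans (+-congˡ (-‿inverseʳ 1#)) (+-identityʳ x)))

  i₀ : Fin N
  i₀ = index 0#

  index≡i₀⇒≈0 : ∀ {x} → index x ≡ i₀ → x ≈ 0#
  index≡i₀⇒≈0 {x} ix≡i₀ = trans (sym (enum-index x)) (trans (reflexive (≡.cong enum ix≡i₀)) (enum-index 0#))

  -- enum with its zero replaced by 1, so that its product is a unit
  enum₁ : Fin N → Carrier
  enum₁ i with i Fin.≟ i₀
  ... | yes _ = 1#
  ... | no _ = enum i

  enum₁-nonZero : ∀ i → ¬ enum₁ i ≈ 0#
  enum₁-nonZero i with i Fin.≟ i₀
  ... | yes _ = 1≉0
  ... | no i≢i₀ = λ enum-i≈0 → i≢i₀ (≡.sym (index-unique enum-i≈0))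

  enum₁-≢i₀ : ∀ {i} → i ≢ i₀ → enum₁ i ≡ enum i
  enum₁-≢i₀ {i} i≢i₀ with i Fin.≟ i₀
  ... | yes i≡i₀ = contradiction i≡i₀ i≢i₀
  ... | no _ = ≡.refl

  fermat : ∀ x → x ^F N ≈ x
  fermat x with x ≟ 0#
  ... | yes x≈0 = trans (^F-congˡ N x≈0) (trans (0^F≈0 N) (sym x≈0))
  ... | no x≉0 = *-cancelʳ (product-nonZero enum₁ enum₁-nonZero) (begin
    x ^F N * product enum₁                 ≈⟨ *-congʳ (^F≈^ x N) ⟩
    x ^ N * product enum₁                  ≈⟨ *-congʳ (Product.sum-replicate N) ⟨
    product {N} (λ _ → x) * product enum₁  ≈⟨ Product.∑-distrib-+ (λ _ → x) enum₁ ⟨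
    product (λ i → x * enum₁ i)            ≈⟨ product-except _ _ i₀ away-from-i₀ at-i₀ ⟩
    x * product (λ i → enum₁ (π ⟨$⟩ʳ i))   ≈⟨ *-congˡ (Product.∑-permute enum₁ π) ⟨
    x * product enum₁                      ∎)
    where
    x⁻¹ = inv x x≉0
    x⁻¹x≈1 = trans (*-comm x⁻¹ x) (*-inverseʳ x x≉0)
    π = reindexing (x *_) (x⁻¹ *_) *-congˡ *-congˡ
      (λ y → trans (sym (*-assoc x x⁻¹ y)) (trans (*-congʳ (*-inverseʳ x x≉0)) (*-identityˡ y)))
      (λ y → trans (sym (*-assoc x⁻¹ x y)) (trans (*-congʳ x⁻¹x≈1) (*-identityˡ y)))
    away-from-i₀ : ∀ j → j ≢ i₀ → x * enum₁ j ≈ enum₁ (π ⟨$⟩ʳ j)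
    away-from-i₀ j j≢i₀ = begin
      x * enum₁ j            ≡⟨ ≡.cong (x *_) (enum₁-≢i₀ j≢i₀) ⟩
      x * enum j             ≈⟨ enum-index (x * enum j) ⟨
      enum (π ⟨$⟩ʳ j)        ≡⟨ enum₁-≢i₀ πj≢i₀ ⟨
      enum₁ (π ⟨$⟩ʳ j)       ∎
      where
      πj≢i₀ : π ⟨$⟩ʳ j ≢ i₀
      πj≢i₀ πj≡i₀ = j≢i₀ (≡.sym (index-unique (x*y≈0⇒y≈0 x≉0 (index≡i₀⇒≈0 πj≡i₀))))
    at-i₀ : x * enum₁ i₀ ≈ x * enum₁ (π ⟨$⟩ʳ i₀)
    at-i₀ = reflexive (≡.cong (λ i → x * enum₁ i) (≡.sym (index-unique (begin
      enum i₀       ≈⟨ enum-index 0# ⟩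
      0#            ≈⟨ zeroʳ x ⟨
      x * 0#        ≈⟨ *-congˡ (enum-index 0#) ⟨
      x * enum i₀   ∎))))

  cubics-common-roots-equal : ∀ {c₀ c₁ c₂ c₃ d₀ d₁ d₂ d₃ r s} →
    (∀ d → d ∣P (c₀ ∷ c₁ ∷ c₂ ∷ c₃ ∷ []) → d ∣P (d₀ ∷ d₁ ∷ d₂ ∷ d₃ ∷ []) → HasDegree≤1 d) →
    eval (c₀ ∷ c₁ ∷ c₂ ∷ c₃ ∷ []) r ≈ 0# → eval (d₀ ∷ d₁ ∷ d₂ ∷ d₃ ∷ []) r ≈ 0# →
    eval (c₀ ∷ c₁ ∷ c₂ ∷ c₃ ∷ []) s ≈ 0# → eval (d₀ ∷ d₁ ∷ d₂ ∷ d₃ ∷ []) s ≈ 0# → r ≈ s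
  cubics-common-roots-equal {r = r} {s} gcd-degree≤1 fr≈0 gr≈0 fs≈0 gs≈0 with r ≟ s
  ... | yes r≈s = r≈s
  ... | no r≉s = contradiction
    (gcd-degree≤1 _ (quadraticWithRoots∣cubic _ _ _ _ r≉s fr≈0 fs≈0)
                    (quadraticWithRoots∣cubic _ _ _ _ r≉s gr≈0 gs≈0))
    (¬degree≤1-quadraticWithRoots r s)

  ×1-^ : ∀ m k → (m ^ℕ k) × 1# ≈ (m × 1#) ^F k
  ×1-^ m zero = +-identityʳ 1#
  ×1-^ m (suc k) = trans (×1-homo-* m (m ^ℕ k)) (*-congˡ (×1-^ m k))

  x^F≈0⇒x≈0 : ∀ {x} n → x ^F n ≈ 0# → x ≈ 0#
  x^F≈0⇒x≈0 {x} n xⁿ≈0 with x ≟ 0#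
  ... | yes x≈0 = x≈0
  ... | no x≉0 = contradiction xⁿ≈0 (^F-nonZero n x≉0)

  characteristic : ∀ p k → N ≡ p ^ℕ k → p × 1# ≈ 0#
  characteristic p k N≡pᵏ =
    x^F≈0⇒x≈0 k (trans (sym (×1-^ p k)) (≡.subst (λ n → n × 1# ≈ 0#) N≡pᵏ characteristic∣N))

  all-fixed⇒N≤ : ∀ k → (∀ z → z ^F (2 ℕ.+ k) ≈ z) → N ≤ 2 ℕ.+ k
  all-fixed⇒N≤ k fixed = ≡.subst (N ≤_) (length-X^[2+k]-X k)
    (root-bound (X^[2+k]-X k) 1≉0 enum enum-injective (λ i → begin
      horner 1# (X^[2+k]-X k) (enum i)   ≈⟨ horner-X^[2+k]-X 1# k (enum i) ⟩
      1# * enum i ^F (2 ℕ.+ k) - enum i  ≈⟨ +-congʳ (trans (*-identityˡ _) (fixed (enum i))) ⟩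
      enum i - enum i                    ≈⟨ -‿inverseʳ (enum i) ⟩
      0#                                 ∎))

module QuadraticExtension {c ℓ : Level} (F : Field c ℓ) {p h : ℕ} (p-prime : Prime p) (1≤h : 1 ≤ h)
         (card : FieldOps.HasCardinality F ((p ^ℕ h) ^ℕ 2)) where
  open Field F hiding (zero)
  open FieldOps F
  open FieldProperties F
  open Frobenius F
  open FiniteFieldProperties F card
  open import Relation.Binary.Reasoning.Setoid setoid
  open import Algebra.Solver.Ring.NaturalCoefficients commutativeSemiring (λ _ _ → nothing)
    using (solve; _:=_; _:+_; _:*_; con)
  open import Relation.Nullary using (yes; no)
  open import Data.Product using (_×_)

  q : ℕ
  q = p ^ℕ h

  instance
    _ = prime⇒nonTrivial p-prime
    _ = ℕ.nonTrivial⇒nonZero p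

  2≤q : 2 ≤ q
  2≤q = ℕ.≤-trans (ℕ.nonTrivial⇒n>1 p)
          (ℕ.≤-trans (ℕ.≤-reflexive (≡.sym (ℕ.*-identityʳ p))) (ℕ.^-monoʳ-≤ p 1≤h))

  ^q-additive : AdditivePower q
  ^q-additive = frobenius-^ p-prime (characteristic p (h *ℕ 2) (ℕ.^-*-assoc p h 2)) h

  ^q-involutive : ∀ x → (x ^F q) ^F q ≈ x
  ^q-involutive x = trans (^F-assocʳ x q q) (trans (reflexive (≡.cong (x ^F_) q*q≡q²)) (fermat x))
    where q*q≡q² = ≡.cong (q *ℕ_) (≡.sym (ℕ.*-identityʳ q))

  ∃-non-fixed : ∃ λ z → ¬ z ^F q ≈ z
  ∃-non-fixed with Fin.¬∀⟶∃¬ _ (λ i → enum i ^F q ≈ enum i) (λ i → enum i ^F q ≟ enum i) ¬all-fixed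
    where
    q≡2+k : q ≡ 2 ℕ.+ (q ∸ 2)
    q≡2+k = ≡.sym (ℕ.m+[n∸m]≡n 2≤q)
    q<q² : q < q ^ℕ 2
    q<q² = ℕ.m<m*n q (q ^ℕ 1) {{ℕ.>-nonZero (ℕ.<-trans (s≤s z≤n) 2≤q)}}
             (≡.subst (1 <_) (≡.sym (ℕ.*-identityʳ q)) 2≤q)
    ¬all-fixed : ¬ (∀ i → enum i ^F q ≈ enum i)
    ¬all-fixed fixed = ℕ.<⇒≱ q<q² (≡.subst (q ^ℕ 2 ≤_) (≡.sym q≡2+k) (all-fixed⇒N≤ (q ∸ 2) (λ z →
      ≡.subst (λ n → z ^F n ≈ z) q≡2+k (begin
        z ^F q                 ≈⟨ ^F-congˡ q (enum-index z) ⟨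
        enum (index z) ^F q    ≈⟨ fixed (index z) ⟩
        enum (index z)         ≈⟨ enum-index z ⟩
        z                      ∎))))
  ... | i , ¬fixed = enum i , ¬fixed

  ^q-of-twisted-sum : ∀ {r} → r * r ^F q ≈ 1# → ∀ z → (z + r ^F q * z ^F q) ^F q ≈ (z + r ^F q * z ^F q) * r
  ^q-of-twisted-sum {r} r*r^q≈1 z = begin
    x ^F q                          ≈⟨ ^q-additive z (v * z ^F q) ⟩
    z ^F q + (v * z ^F q) ^F q      ≈⟨ +-congˡ (^F-distrib-* v (z ^F q) q) ⟩
    z ^F q + v ^F q * (z ^F q) ^F q ≈⟨ +-congˡ (*-cong (^q-involutive r) (^q-involutive z)) ⟩
    z ^F q + r * z                  ≈⟨ +-comm (z ^F q) (r * z) ⟩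
    r * z + z ^F q                  ≈⟨ +-congˡ (trans (sym (*-assoc r v _)) (trans (*-congʳ r*r^q≈1) (*-identityˡ _))) ⟨
    r * z + r * (v * z ^F q)        ≈⟨ distribˡ r z (v * z ^F q) ⟨
    r * x                           ≈⟨ *-comm r x ⟩
    x * r                           ∎
    where
    v = r ^F q
    x = z + v * z ^F q

  x^q≈x*r⇒x^[q-1]≈r : ∀ {x r} → ¬ x ≈ 0# → x ^F q ≈ x * r → x ^F (q ∸ 1) ≈ r
  x^q≈x*r⇒x^[q-1]≈r {x} x≉0 x^q≈x*r =
    *-cancelˡ x≉0 (trans (reflexive (≡.cong (x ^F_) (ℕ.m+[n∸m]≡n (ℕ.≤-trans (s≤s z≤n) 2≤q)))) x^q≈x*r)

  nonZero-twisted-sum : ∀ v → ∃ λ z → ¬ z + v * z ^F q ≈ 0#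
  nonZero-twisted-sum v with 1# + v ≟ 0#
  ... | no 1+v≉0 = 1# , λ 1+v*1≈0 →
    1+v≉0 (trans (+-congˡ (sym (trans (*-congˡ (1^F≈1 q)) (*-identityʳ v)))) 1+v*1≈0)
  ... | yes 1+v≈0 with ∃-non-fixed
  ...   | z , z^q≉z = z , λ x≈0 → z^q≉z (begin
    z ^F q                     ≈⟨ +-identityʳ (z ^F q) ⟨
    z ^F q + 0#                ≈⟨ +-congˡ x≈0 ⟨
    z ^F q + (z + v * z ^F q)  ≈⟨ solve 3 (λ Z z v → Z :+ (z :+ v :* Z) := Z :* (con 1 :+ v) :+ z) refl (z ^F q) z v ⟩
    z ^F q * (1# + v) + z      ≈⟨ +-congʳ (trans (*-congˡ 1+v≈0) (zeroʳ (z ^F q))) ⟩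
    0# + z                     ≈⟨ +-identityˡ z ⟩
    z                          ∎)

  hilbert90 : ∀ {r} → r * r ^F q ≈ 1# → ∃ λ x → ¬ x ≈ 0# × x ^F (q ∸ 1) ≈ r
  hilbert90 {r} r*r^q≈1 with nonZero-twisted-sum (r ^F q)
  ... | z , x≉0 = z + r ^F q * z ^F q , x≉0 , x^q≈x*r⇒x^[q-1]≈r x≉0 (^q-of-twisted-sum r*r^q≈1 z)

  f : Carrier → Carrier → Carrier → Carrier
  f a b x = x * (1# + a * x ^F (q *ℕ (q ∸ 1)) + b * x ^F (2 *ℕ (q ∸ 1)))

  G : Carrier → Carrier → Poly
  G a b = b ^F q ∷ 0# ∷ 1# ∷ a ^F q ∷ []

  H : Carrier → Carrier → Poly
  H a b = a ∷ 1# ∷ 0# ∷ b ∷ []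

  f-at-[q-1]-power : ∀ a b {x ρ} → x ^F (q ∸ 1) ≈ ρ → f a b x ≈ x * (1# + a * ρ ^F q + b * ρ ^F 2)
  f-at-[q-1]-power a b {x} x^[q-1]≈ρ = *-congˡ (+-cong (+-congˡ (*-congˡ (power q))) (*-congˡ (power 2)))
    where
    power : ∀ k → x ^F (k *ℕ (q ∸ 1)) ≈ _ ^F k
    power k = begin
      x ^F (k *ℕ (q ∸ 1))   ≡⟨ ≡.cong (x ^F_) (ℕ.*-comm k (q ∸ 1)) ⟩
      x ^F ((q ∸ 1) *ℕ k)   ≈⟨ ^F-assocʳ x (q ∸ 1) k ⟨
      (x ^F (q ∸ 1)) ^F k   ≈⟨ ^F-congˡ k x^[q-1]≈ρ ⟩
      _ ^F k                ∎

  reciprocal-conjugate-root : ∀ c₀ c₁ c₂ c₃ g {ρ} (ρ≉0 : ¬ ρ ≈ 0#) →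
    (c₃ ∷ c₂ ∷ c₁ ∷ c₀ ∷ []) ≈P map (_^F q) g → eval g ρ ≈ 0# →
    eval (c₀ ∷ c₁ ∷ c₂ ∷ c₃ ∷ []) (inv (ρ ^F q) (^F-nonZero q ρ≉0)) ≈ 0#
  reciprocal-conjugate-root c₀ c₁ c₂ c₃ g {ρ} ρ≉0 reverse≈conjugate gρ≈0 =
    x*y≈0⇒y≈0 (x*y≉0 t≉0 (x*y≉0 t≉0 t≉0)) (begin
      t * (t * t) * eval (c₀ ∷ c₁ ∷ c₂ ∷ c₃ ∷ []) (inv t t≉0)  ≈⟨ eval-reverse-cubic c₀ c₁ c₂ c₃ (*-inverseʳ t t≉0) ⟩
      eval (c₃ ∷ c₂ ∷ c₁ ∷ c₀ ∷ []) t                        ≈⟨ eval-cong _ _ t reverse≈conjugate ⟩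
      eval (map (_^F q) g) t                                 ≈⟨ eval-^F q ^q-additive g ρ ⟨
      eval g ρ ^F q                                          ≈⟨ ^F-congˡ q gρ≈0 ⟩
      0# ^F q                                                ≈⟨ additive⇒0^F≈0 q ^q-additive ⟩
      0#                                                     ∎)
    where
    t = ρ ^F q
    t≉0 = ^F-nonZero q ρ≉0

  common-root-has-norm-one : ∀ a b {ρ} → ¬ b ≈ 0# → (∀ d → d ∣P G a b → d ∣P H a b → HasDegree≤1 d) →
                             eval (G a b) ρ ≈ 0# → eval (H a b) ρ ≈ 0# → ρ * ρ ^F q ≈ 1#
  common-root-has-norm-one a b {ρ} b≉0 gcd-degree≤1 Gρ≈0 Hρ≈0 = begin
    ρ * t   ≈⟨ *-comm ρ t ⟩
    t * ρ   ≈⟨ *-congˡ (cubics-common-roots-equal gcd-degree≤1 Gs≈0 Hs≈0 Gρ≈0 Hρ≈0) ⟨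
    t * s   ≈⟨ *-inverseʳ t t≉0 ⟩
    1#      ∎
    where
    ρ≉0 : ¬ ρ ≈ 0#
    ρ≉0 ρ≈0 = ^F-nonZero q b≉0 (trans (sym (eval-at-0 (b ^F q) (0# ∷ 1# ∷ a ^F q ∷ []) ρ≈0)) Gρ≈0)
    t = ρ ^F q
    t≉0 = ^F-nonZero q ρ≉0
    s = inv t t≉0
    Gs≈0 = reciprocal-conjugate-root _ _ _ _ (H a b) ρ≉0
             (refl , sym (1^F≈1 q) , sym (additive⇒0^F≈0 q ^q-additive) , refl , []) Hρ≈0
    Hs≈0 = reciprocal-conjugate-root _ _ _ _ (G a b) ρ≉0
             (sym (^q-involutive b) , sym (additive⇒0^F≈0 q ^q-additive) , sym (1^F≈1 q) , sym (^q-involutive a) , [])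
             Gρ≈0

  H-root⇒factor≈0 : ∀ a b {ρ} → ρ * ρ ^F q ≈ 1# → eval (H a b) ρ ≈ 0# → 1# + a * ρ ^F q + b * ρ ^F 2 ≈ 0#
  H-root⇒factor≈0 a b {ρ} ρ*ρ^q≈1 Hρ≈0 = x*y≈0⇒y≈0 ρ≉0 (begin
    ρ * (1# + a * ρ ^F q + b * ρ ^F 2)          ≈⟨ solve 4 (λ ρ a R b →
                                                     ρ :* (con 1 :+ a :* R :+ b :* (ρ :* (ρ :* con 1)))
                                                     := a :* (ρ :* R) :+ ρ :* (con 1 :+ ρ :* (ρ :* b)))
                                                     refl ρ a (ρ ^F q) b ⟩
    a * (ρ * ρ ^F q) + ρ * (1# + ρ * (ρ * b))    ≈⟨ +-cong (trans (*-congˡ ρ*ρ^q≈1) (*-identityʳ a))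
                                                      (*-congˡ (+-congˡ (*-congˡ (sym (+-identityˡ (ρ * b)))))) ⟩
    a + ρ * (1# + ρ * (0# + ρ * b))              ≈⟨ eval-cubic a 1# 0# b ρ ⟨
    eval (H a b) ρ                               ≈⟨ Hρ≈0 ⟩
    0#                                           ∎)
    where
    ρ≉0 : ¬ ρ ≈ 0#
    ρ≉0 ρ≈0 = 1≉0 (trans (sym ρ*ρ^q≈1) (trans (*-congʳ ρ≈0) (zeroˡ _)))

  Injective : (Carrier → Carrier) → Set (c ⊔ ℓ)
  Injective φ = ∀ x y → φ x ≈ φ y → x ≈ y

  norm-one-root⇒¬injective : ∀ a b {ρ} → ρ * ρ ^F q ≈ 1# → eval (H a b) ρ ≈ 0# → ¬ Injective (f a b)
  norm-one-root⇒¬injective a b {ρ} ρ*ρ^q≈1 Hρ≈0 f-injective with hilbert90 ρ*ρ^q≈1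
  ... | x , x≉0 , x^[q-1]≈ρ = x≉0 (f-injective x 0# (begin
    f a b x                                  ≈⟨ f-at-[q-1]-power a b x^[q-1]≈ρ ⟩
    x * (1# + a * ρ ^F q + b * ρ ^F 2)       ≈⟨ *-congˡ (H-root⇒factor≈0 a b ρ*ρ^q≈1 Hρ≈0) ⟩
    x * 0#                                   ≈⟨ zeroʳ x ⟩
    0#                                       ≈⟨ zeroˡ _ ⟨
    f a b 0#                                 ∎))

  ¬injective : ∀ a b → ¬ b ≈ 0# → GcdHasDegreeOne (G a b) (H a b) → ¬ Injective (f a b)
  ¬injective a b b≉0 gcd with common-root gcd
  ... | ρ , Gρ≈0 , Hρ≈0 =
    norm-one-root⇒¬injective a b (common-root-has-norm-one a b b≉0 (proj₂ gcd) Gρ≈0 Hρ≈0) Hρ≈0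

proposition4p1 : ∀ {c ℓ : Level} (F : Field c ℓ) (p h : ℕ) → Prime p → 3 < p → 1 ≤ h →
    let open Field F
        open FieldOps F
        q = p ^ℕ h
    in HasCardinality (q ^ℕ 2) →
       ∀ (a b : Carrier) → ¬ (a ≈ 0#) → ¬ (b ≈ 0#) →
       GcdHasDegreeOne (b ^F q ∷ 0# ∷ 1# ∷ a ^F q ∷ []) (a ∷ 1# ∷ 0# ∷ b ∷ []) →
       ¬ IsBijection (λ x → x * (1# + a * x ^F (q *ℕ (q ∸ 1)) + b * x ^F (2 *ℕ (q ∸ 1))))
proposition4p1 F p h p-prime _ 1≤h card a b _ b≉0 gcd (f-injective , _) =
  QuadraticExtension.¬injective F p-prime 1≤h card a b b≉0 gcd f-injective
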